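{- (a) Let $p\in\mathbb Z[x]$ be a nice antisymmetric polynomial of degree $d\ge3$ whose center $C\in\mathbb Z$ is a root of $p$ of multiplicity one. Then $d$ is the square of an odd integer. (b) Let $p\in\mathbb Z[x]$ be a symmetric polynomial of degree $d\ge4$ all of whose roots lie in $\mathbb Z$, whose center $C\in\mathbb Z$ is not a root of $p$, and whose derivative $p'$ is nice. Then $d-1$ is the square of an odd integer.
   Context: A polynomial $f\in\mathbb Z[x]$ of degree $n\ge2$ is nice if $f$ and its derivative $f'$ both factor as products of linear factors over $\mathbb Z$ (i.e. $f=c\prod(x-x_i)$, $f'=c'\prod(x-x'_j)$ with all $c,c',x_i,x'_j\in\mathbb Z$). A non-constant $p\in\mathbb Z[x]$ is symmetric (resp. antisymmetric) if there is $C\in\mathbb Z$, its center, with $p(C-a)=p(C+a)$ (resp. $p(C-a)=-p(C+a)$) for all $a\in\mathbb Z$. -}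

module Defs where

open import Data.Nat as ℕ using (ℕ; zero; suc)
open import Data.Integer using (ℤ; +_; _+_; _*_; -_; _-_)
open import Data.List using (List; []; _∷_; map)
open import Data.Product using (Σ; ∃; _×_; _,_)
open import Relation.Binary.PropositionalEquality using (_≡_)
open import Relation.Nullary using (¬_)

-- Polynomials over ℤ as coefficient lists, lowest degree first:
-- a₀ ∷ a₁ ∷ … ∷ aₙ ∷ []  represents  a₀ + a₁ x + … + aₙ xⁿ.
-- Trailing zeros are allowed; equality of polynomials is coefficientwise.
Poly : Set
Poly = List ℤ

coeff : Poly → ℕ → ℤ
coeff []       _       = + 0
coeff (a ∷ _)  zero    = a
coeff (_ ∷ as) (suc k) = coeff as k

_≈ₚ_ : Poly → Poly → Set
p ≈ₚ q = ∀ k → coeff p k ≡ coeff q k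

eval : Poly → ℤ → ℤ
eval []       _ = + 0
eval (a ∷ as) x = a + x * eval as x

_+ₚ_ : Poly → Poly → Poly
[]       +ₚ q        = q
(a ∷ p)  +ₚ []       = a ∷ p
(a ∷ p)  +ₚ (b ∷ q)  = (a + b) ∷ (p +ₚ q)

scale : ℤ → Poly → Poly
scale c p = map (c *_) p

_*ₚ_ : Poly → Poly → Poly
[]      *ₚ q = []
(a ∷ p) *ₚ q = scale a q +ₚ (+ 0 ∷ (p *ₚ q))

constP : ℤ → Poly
constP c = c ∷ []

lin : ℤ → Poly
lin a = (- a) ∷ + 1 ∷ []

_^ₚ_ : Poly → ℕ → Poly
p ^ₚ zero  = constP (+ 1)
p ^ₚ suc m = p *ₚ (p ^ₚ m)

prodLin : List ℤ → Poly
prodLin []       = constP (+ 1)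
prodLin (x ∷ xs) = lin x *ₚ prodLin xs

derivAux : ℕ → Poly → Poly
derivAux k []       = []
derivAux k (a ∷ as) = (+ k * a) ∷ derivAux (suc k) as

deriv : Poly → Poly
deriv []       = []
deriv (_ ∷ as) = derivAux 1 as

HasDegree : Poly → ℕ → Set
HasDegree p d = ¬ (coeff p d ≡ + 0) × (∀ k → d ℕ.< k → coeff p k ≡ + 0)

SplitsOverℤ : Poly → Set
SplitsOverℤ f = Σ ℤ λ c → Σ (List ℤ) λ xs → f ≈ₚ (constP c *ₚ prodLin xs)

Nice : Poly → Set
Nice f = Σ ℕ λ n → HasDegree f n × 2 ℕ.≤ n × SplitsOverℤ f × SplitsOverℤ (deriv f)

NonConstant : Poly → Set
NonConstant p = Σ ℕ λ n → HasDegree p n × 1 ℕ.≤ n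

SymmetricAbout : Poly → ℤ → Set
SymmetricAbout p C = NonConstant p × (∀ a → eval p (C - a) ≡ eval p (C + a))

AntisymmetricAbout : Poly → ℤ → Set
AntisymmetricAbout p C = NonConstant p × (∀ a → eval p (C - a) ≡ - eval p (C + a))

_^_∣ₚ_ : ℤ → ℕ → Poly → Set
a ^ m ∣ₚ p = Σ Poly λ q → p ≈ₚ ((lin a ^ₚ m) *ₚ q)

SimpleRoot : ℤ → Poly → Set
SimpleRoot a p = (a ^ 1 ∣ₚ p) × ¬ (a ^ 2 ∣ₚ p)

OddSquare : ℕ → Set
OddSquare n = Σ ℕ λ k → n ≡ (1 ℕ.+ 2 ℕ.* k) ℕ.* (1 ℕ.+ 2 ℕ.* k)

module Submission where

-- If p = c ∏ (x − xᵢ) is odd about C, then C is a root and the other roots lie symmetrically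
-- about C; when C is a simple root they pair off as C ± wᵢ, so d = 2m + 1 and
-- p'(C) = c (−1)ᵐ (∏ wᵢ)². Now p' is even about C, nonzero at C and splits with leading
-- coefficient d c, so its roots pair off as C ± vⱼ as well and p'(C) = d c (−1)ᵐ (∏ vⱼ)².
-- Hence (∏ wᵢ)² = d (∏ vⱼ)², and the odd number d is a perfect square.
-- In (b) the roots of p pair off as C ± wᵢ, which makes p' odd about C with
-- p''(C) = ± 2c Σᵢ ∏_{j≠i} wⱼ² ≠ 0, so the argument of (a) applies to p'.
-- Pairing off the roots is an induction: after removing one pair C ± w, cancelling its factor shows
-- the remaining product is even about C at all points C ± a with |a| > |w|, hence everywhere by
-- the identity theorem for polynomials.

open import Defs
open import Data.Nat using (ℕ; _≤_; _∸_)
open import Data.Integer using (ℤ; +_)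
open import Data.Product using (_×_)
open import Relation.Binary.PropositionalEquality using (_≡_)
open import Relation.Nullary using (¬_)

open import Relation.Nullary using (contradiction; yes; no)
open import Data.Nat as ℕ using (zero; suc; _<_)
open import Data.Nat.Divisibility using (_∣_; divides; >⇒∤; ∣-refl)
open import Data.Nat.GCD using (gcd; GCD; gcd-GCD; GCD-*; gcd[m,n]≢0)
open import Data.Nat.Coprimality using (Coprime; GCD≡1⇒coprime; coprime-divisor) renaming (sym to Coprime-sym)
import Data.Nat.Tactic.RingSolver as NS
import Data.Nat.Properties as ℕP
open import Data.Integer as ℤ using (_+_; _*_; -_; _-_; ∣_∣; 0ℤ; 1ℤ; -1ℤ; _^_)
import Data.Integer.Properties as ℤP
open import Data.Integer.Tactic.RingSolver using (solve-∀)
open import Data.List using (List; []; _∷_; foldr; map; length; drop)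
open import Data.Product using (∃-syntax; _,_; proj₁; proj₂)
open import Data.Sum using (_⊎_; inj₁; inj₂; [_,_]′; reduce)
open import Relation.Binary.Definitions using (tri<; tri≈; tri>)
open import Function using (_∘_)
open import Relation.Binary.PropositionalEquality
  using (_≢_; refl; sym; trans; cong; cong₂; subst; subst₂; module ≡-Reasoning)
open ≡-Reasoning

cong₃ : ∀ {A B D E : Set} (f : A → B → D → E) {a a′ b b′ d d′} → a ≡ a′ → b ≡ b′ → d ≡ d′ → f a b d ≡ f a′ b′ d′
cong₃ f refl refl refl = refl

*-cancelˡ-≢0 : ∀ c {i j} → c ≢ 0ℤ → c * i ≡ c * j → i ≡ j
*-cancelˡ-≢0 c {i} {j} c≢0 = ℤP.*-cancelˡ-≡ c i j {{ℤ.≢-nonZero c≢0}}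

*-≢0 : ∀ {i j} → i ≢ 0ℤ → j ≢ 0ℤ → i * j ≢ 0ℤ
*-≢0 {i} i≢0 j≢0 ij≡0 = [ i≢0 , j≢0 ]′ (ℤP.i*j≡0⇒i≡0∨j≡0 i ij≡0)

*-≡0⇒≡0 : ∀ c {i} → c ≢ 0ℤ → c * i ≡ 0ℤ → i ≡ 0ℤ
*-≡0⇒≡0 c {i} c≢0 ci≡0 = *-cancelˡ-≢0 c c≢0 (trans ci≡0 (sym (ℤP.*-zeroʳ c)))

i≡-i⇒i≡0 : ∀ {i} → i ≡ - i → i ≡ 0ℤ
i≡-i⇒i≡0 {i} i≡-i = *-≡0⇒≡0 (+ 2) (λ ()) (begin
  + 2 * i  ≡⟨ double i ⟩
  i + i    ≡⟨ cong (λ v → i + v) i≡-i ⟩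
  i + - i  ≡⟨ ℤP.+-inverseʳ i ⟩
  0ℤ       ∎)
  where
  double : ∀ i → + 2 * i ≡ i + i
  double = solve-∀

-1^n≢0 : ∀ n → -1ℤ ^ n ≢ 0ℤ
-1^n≢0 n -1^n≡0 with ℤP.i^n≡0⇒i≡0 -1ℤ n -1^n≡0
... | ()

+-≡⇒-≡ : ∀ a b c d → a + c ≡ b + d → a - b ≡ d - c
+-≡⇒-≡ a b c d a+c≡b+d = begin
  a - b             ≡⟨ add-c a b c ⟩
  (a + c) - (b + c) ≡⟨ cong (λ v → v - (b + c)) a+c≡b+d ⟩
  (b + d) - (b + c) ≡⟨ cancel-b b c d ⟩
  d - c             ∎
  where
  add-c : ∀ a b c → a - b ≡ (a + c) - (b + c)
  add-c = solve-∀
  cancel-b : ∀ b c d → (b + d) - (b + c) ≡ d - c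
  cancel-b = solve-∀

i*i≡+∣i∣*∣i∣ : ∀ i → i * i ≡ + (∣ i ∣ ℕ.* ∣ i ∣)
i*i≡+∣i∣*∣i∣ (+ n)       = sym (ℤP.pos-* n n)
i*i≡+∣i∣*∣i∣ ℤ.-[1+ n ] = refl

square-ratio⇒square : ∀ a b n → b ≢ 0 → a ℕ.* a ≡ n ℕ.* (b ℕ.* b) → ∃[ k ] n ≡ k ℕ.* k
square-ratio⇒square a b n b≢0 a²≡nb² = lowest-terms (gcd a b) (gcd-GCD a b) (gcd[m,n]≢0 a b (inj₂ b≢0))
  where
  -- With a = a′ g and b = b′ g in lowest terms, b′ divides a′² and is coprime to a′, so b′ = 1.
  lowest-terms : ∀ g → GCD a b g → g ≢ 0 → ∃[ k ] n ≡ k ℕ.* k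
  lowest-terms zero    _   g≢0 = contradiction refl g≢0
  lowest-terms (suc g) gcd _ with GCD.commonDivisor gcd
  ... | divides a′ a≡a′g , divides b′ b≡b′g = a′ , sym a′²≡n
    where
    coprime : Coprime a′ b′
    coprime = GCD≡1⇒coprime (GCD-* {a′} {b′} {1} {suc g}
      (subst₂ (λ u v → GCD u v (1 ℕ.* suc g)) a≡a′g b≡b′g (subst (GCD a b) (sym (ℕP.*-identityˡ (suc g))) gcd)))
    scale-out : ∀ a′ b′ g → a′ ℕ.* g ℕ.* (a′ ℕ.* g) ≡ n ℕ.* (b′ ℕ.* g ℕ.* (b′ ℕ.* g)) →
                a′ ℕ.* a′ ℕ.* (g ℕ.* g) ≡ n ℕ.* (b′ ℕ.* b′) ℕ.* (g ℕ.* g)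
    scale-out a′ b′ g e = trans (lhs a′ g) (trans e (rhs n b′ g))
      where
      lhs : ∀ a′ g → a′ ℕ.* a′ ℕ.* (g ℕ.* g) ≡ a′ ℕ.* g ℕ.* (a′ ℕ.* g)
      lhs = NS.solve-∀
      rhs : ∀ n b′ g → n ℕ.* (b′ ℕ.* g ℕ.* (b′ ℕ.* g)) ≡ n ℕ.* (b′ ℕ.* b′) ℕ.* (g ℕ.* g)
      rhs = NS.solve-∀
    a′²≡nb′² : a′ ℕ.* a′ ≡ n ℕ.* (b′ ℕ.* b′)
    a′²≡nb′² = ℕP.*-cancelʳ-≡ _ _ (suc g ℕ.* suc g)
      (scale-out a′ b′ (suc g) (subst₂ (λ u v → u ℕ.* u ≡ n ℕ.* (v ℕ.* v)) a≡a′g b≡b′g a²≡nb²))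
    b′≡1 : b′ ≡ 1
    b′≡1 = coprime (coprime-divisor (Coprime-sym coprime) (divides (n ℕ.* b′) (trans a′²≡nb′² (sym (ℕP.*-assoc n b′ b′)))) , ∣-refl)
    a′²≡n : a′ ℕ.* a′ ≡ n
    a′²≡n = trans a′²≡nb′² (trans (cong (λ v → n ℕ.* (v ℕ.* v)) b′≡1) (ℕP.*-identityʳ n))

even⊎odd : ∀ k → (∃[ j ] k ≡ 2 ℕ.* j) ⊎ (∃[ j ] k ≡ suc (2 ℕ.* j))
even⊎odd zero    = inj₁ (0 , refl)
even⊎odd (suc k) with even⊎odd k
... | inj₁ (j , k≡2j)   = inj₂ (j , cong suc k≡2j)
... | inj₂ (j , k≡1+2j) = inj₁ (suc j , trans (cong suc k≡1+2j) (sym (ℕP.*-suc 2 j)))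

odd-square : ∀ m k → suc (2 ℕ.* m) ≡ k ℕ.* k → OddSquare (suc (2 ℕ.* m))
odd-square m k 1+2m≡k² with even⊎odd k
... | inj₂ (j , k≡1+2j) = j , trans 1+2m≡k² (cong₂ ℕ._*_ k≡1+2j k≡1+2j)
... | inj₁ (j , k≡2j)   = contradiction (trans (double j) (trans (cong₂ ℕ._*_ (sym k≡2j) (sym k≡2j)) (sym 1+2m≡k²)))
                                        (ℕP.even≢odd (j ℕ.* (2 ℕ.* j)) m)
  where
  double : ∀ j → 2 ℕ.* (j ℕ.* (2 ℕ.* j)) ≡ 2 ℕ.* j ℕ.* (2 ℕ.* j)
  double = NS.solve-∀

odd-square-ratio : ∀ m A B → B ≢ 0ℤ → A * A ≡ + suc (2 ℕ.* m) * (B * B) → OddSquare (suc (2 ℕ.* m))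
odd-square-ratio m A B B≢0 A²≡dB² = odd-square m k d≡k²
  where
  n = suc (2 ℕ.* m)
  |A|²≡d|B|² : ∣ A ∣ ℕ.* ∣ A ∣ ≡ n ℕ.* (∣ B ∣ ℕ.* ∣ B ∣)
  |A|²≡d|B|² = begin
    ∣ A ∣ ℕ.* ∣ A ∣                ≡⟨ ℤP.abs-* A A ⟨
    ∣ A * A ∣                      ≡⟨ cong ∣_∣ A²≡dB² ⟩
    ∣ + n * (B * B) ∣              ≡⟨ ℤP.abs-* (+ n) (B * B) ⟩
    n ℕ.* ∣ B * B ∣                ≡⟨ cong (n ℕ.*_) (ℤP.abs-* B B) ⟩
    n ℕ.* (∣ B ∣ ℕ.* ∣ B ∣)        ∎
  root = square-ratio⇒square ∣ A ∣ ∣ B ∣ n (B≢0 ∘ ℤP.∣i∣≡0⇒i≡0) |A|²≡d|B|²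
  k = proj₁ root
  d≡k² = proj₂ root

∏ : List ℤ → ℤ
∏ = foldr _*_ 1ℤ

linProd : List ℤ → ℤ → ℤ
linProd xs t = ∏ (map (λ x → t - x) xs)

eval-+ₚ : ∀ P Q t → eval (P +ₚ Q) t ≡ eval P t + eval Q t
eval-+ₚ []      Q       t = sym (ℤP.+-identityˡ _)
eval-+ₚ (a ∷ P) []      t = sym (ℤP.+-identityʳ _)
eval-+ₚ (a ∷ P) (b ∷ Q) t = begin
  a + b + t * eval (P +ₚ Q) t        ≡⟨ cong (λ v → a + b + t * v) (eval-+ₚ P Q t) ⟩
  a + b + t * (eval P t + eval Q t)  ≡⟨ regroup a b t (eval P t) (eval Q t) ⟩
  a + t * eval P t + (b + t * eval Q t) ∎
  where
  regroup : ∀ a b t x y → a + b + t * (x + y) ≡ a + t * x + (b + t * y)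
  regroup = solve-∀

eval-scale : ∀ c P t → eval (scale c P) t ≡ c * eval P t
eval-scale c []      t = sym (ℤP.*-zeroʳ c)
eval-scale c (a ∷ P) t = begin
  c * a + t * eval (scale c P) t ≡⟨ cong (λ v → c * a + t * v) (eval-scale c P t) ⟩
  c * a + t * (c * eval P t)     ≡⟨ regroup c a t (eval P t) ⟩
  c * (a + t * eval P t)         ∎
  where
  regroup : ∀ c a t x → c * a + t * (c * x) ≡ c * (a + t * x)
  regroup = solve-∀

eval-*ₚ : ∀ P Q t → eval (P *ₚ Q) t ≡ eval P t * eval Q t
eval-*ₚ []      Q t = refl
eval-*ₚ (a ∷ P) Q t = begin
  eval (scale a Q +ₚ (+ 0 ∷ (P *ₚ Q))) t           ≡⟨ eval-+ₚ (scale a Q) _ t ⟩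
  eval (scale a Q) t + (+ 0 + t * eval (P *ₚ Q) t) ≡⟨ cong₂ (λ u v → u + (+ 0 + t * v)) (eval-scale a Q t) (eval-*ₚ P Q t) ⟩
  a * eval Q t + (+ 0 + t * (eval P t * eval Q t)) ≡⟨ regroup a t (eval P t) (eval Q t) ⟩
  (a + t * eval P t) * eval Q t                    ∎
  where
  regroup : ∀ a t x y → a * y + (+ 0 + t * (x * y)) ≡ (a + t * x) * y
  regroup = solve-∀

eval-constP : ∀ c t → eval (constP c) t ≡ c
eval-constP c t = trans (cong (λ v → c + v) (ℤP.*-zeroʳ t)) (ℤP.+-identityʳ c)

eval-lin : ∀ a t → eval (lin a) t ≡ t - a
eval-lin = lemma
  where
  lemma : ∀ a t → - a + t * (1ℤ + t * 0ℤ) ≡ t - a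
  lemma = solve-∀

eval-constP-*ₚ : ∀ c P t → eval (constP c *ₚ P) t ≡ c * eval P t
eval-constP-*ₚ c P t = trans (eval-*ₚ (constP c) P t) (cong (_* eval P t) (eval-constP c t))

eval-prodLin : ∀ xs t → eval (prodLin xs) t ≡ linProd xs t
eval-prodLin []       t = eval-constP 1ℤ t
eval-prodLin (x ∷ xs) t = trans (eval-*ₚ (lin x) (prodLin xs) t)
                               (cong₂ _*_ (eval-lin x t) (eval-prodLin xs t))

eval-uncons : ∀ P t → eval P t ≡ coeff P 0 + t * eval (drop 1 P) t
eval-uncons []      t = sym (trans (ℤP.+-identityˡ _) (ℤP.*-zeroʳ t))
eval-uncons (a ∷ P) t = refl

coeff-drop1 : ∀ P k → coeff P (suc k) ≡ coeff (drop 1 P) k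
coeff-drop1 []      k = refl
coeff-drop1 (a ∷ P) k = refl

eval-resp-≈ₚ : ∀ P Q → P ≈ₚ Q → ∀ t → eval P t ≡ eval Q t
eval-resp-≈ₚ []      []      P≈Q t = refl
eval-resp-≈ₚ []      (b ∷ Q) P≈Q t = trans (eval-uncons [] t)
  (cong₂ (λ u v → u + t * v) (P≈Q 0) (eval-resp-≈ₚ [] Q (P≈Q ∘ suc) t))
eval-resp-≈ₚ (a ∷ P) Q       P≈Q t = trans
  (cong₂ (λ u v → u + t * v) (P≈Q 0) (eval-resp-≈ₚ P (drop 1 Q) (λ k → trans (P≈Q (suc k)) (coeff-drop1 Q k)) t))
  (sym (eval-uncons Q t))

-- The identity theorem

∣∧<⇒≡0 : ∀ {m n} → n ∣ m → m < n → m ≡ 0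
∣∧<⇒≡0 {zero}  _   _   = refl
∣∧<⇒≡0 {suc m} n∣m m<n = contradiction n∣m (>⇒∤ m<n)

-- a − b is a multiple of every large n, hence zero.
affine-agreement : ∀ N a b (x y : ℕ → ℤ) →
                   (∀ n → N < n → a + + n * x n ≡ b + + n * y n) →
                   a ≡ b × (∀ n → N < n → x n ≡ y n)
affine-agreement N a b x y agree = a≡b , x≡y
  where
  difference : ∀ n → N < n → a - b ≡ + n * (y n - x n)
  difference n N<n = trans (+-≡⇒-≡ a b _ _ (agree n N<n)) (factor (+ n) (y n) (x n))
    where
    factor : ∀ n y x → n * y - n * x ≡ n * (y - x)
    factor = solve-∀
  n₀ : ℕ
  n₀ = suc (N ℕ.+ ∣ a - b ∣)
  n₀∣∣a-b∣ : n₀ ∣ ∣ a - b ∣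
  n₀∣∣a-b∣ = divides ∣ y n₀ - x n₀ ∣ (begin
    ∣ a - b ∣                  ≡⟨ cong ∣_∣ (difference n₀ (ℕ.s≤s (ℕP.m≤m+n N _))) ⟩
    ∣ + n₀ * (y n₀ - x n₀) ∣   ≡⟨ ℤP.abs-* (+ n₀) (y n₀ - x n₀) ⟩
    n₀ ℕ.* ∣ y n₀ - x n₀ ∣     ≡⟨ ℕP.*-comm n₀ _ ⟩
    ∣ y n₀ - x n₀ ∣ ℕ.* n₀     ∎)
  a≡b : a ≡ b
  a≡b = ℤP.i-j≡0⇒i≡j a b (ℤP.∣i∣≡0⇒i≡0 (∣∧<⇒≡0 n₀∣∣a-b∣ (ℕ.s≤s (ℕP.m≤n+m _ N))))
  x≡y : ∀ n → N < n → x n ≡ y n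
  x≡y (suc m) N<n = sym (ℤP.i-j≡0⇒i≡j (y (suc m)) (x (suc m))
    (*-≡0⇒≡0 (+ suc m) (λ ()) (trans (sym (difference (suc m) N<n)) (ℤP.i≡j⇒i-j≡0 a≡b))))

uncons-agreement : ∀ N P Q → (∀ n → N < n → eval P (+ n) ≡ eval Q (+ n)) →
                   coeff P 0 ≡ coeff Q 0 × (∀ n → N < n → eval (drop 1 P) (+ n) ≡ eval (drop 1 Q) (+ n))
uncons-agreement N P Q agree = affine-agreement N (coeff P 0) (coeff Q 0)
  (λ n → eval (drop 1 P) (+ n)) (λ n → eval (drop 1 Q) (+ n))
  (λ n N<n → trans (sym (eval-uncons P (+ n))) (trans (agree n N<n) (eval-uncons Q (+ n))))

eval-agree⇒≈ₚ : ∀ N P Q → (∀ n → N < n → eval P (+ n) ≡ eval Q (+ n)) → P ≈ₚ Q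
eval-agree⇒≈ₚ N P Q agree zero    = proj₁ (uncons-agreement N P Q agree)
eval-agree⇒≈ₚ N P Q agree (suc k) = begin
  coeff P (suc k)          ≡⟨ coeff-drop1 P k ⟩
  coeff (drop 1 P) k       ≡⟨ eval-agree⇒≈ₚ N (drop 1 P) (drop 1 Q) (proj₂ (uncons-agreement N P Q agree)) k ⟩
  coeff (drop 1 Q) k       ≡⟨ coeff-drop1 Q k ⟨
  coeff Q (suc k)          ∎

eval-≗⇒≈ₚ : ∀ P Q → (∀ t → eval P t ≡ eval Q t) → P ≈ₚ Q
eval-≗⇒≈ₚ P Q P≗Q = eval-agree⇒≈ₚ 0 P Q (λ n _ → P≗Q (+ n))

coeff-+ₚ : ∀ P Q k → coeff (P +ₚ Q) k ≡ coeff P k + coeff Q k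
coeff-+ₚ []      Q       k       = sym (ℤP.+-identityˡ _)
coeff-+ₚ (a ∷ P) []      k       = sym (ℤP.+-identityʳ _)
coeff-+ₚ (a ∷ P) (b ∷ Q) zero    = refl
coeff-+ₚ (a ∷ P) (b ∷ Q) (suc k) = coeff-+ₚ P Q k

coeff-scale : ∀ c P k → coeff (scale c P) k ≡ c * coeff P k
coeff-scale c []      k       = sym (ℤP.*-zeroʳ c)
coeff-scale c (a ∷ P) zero    = refl
coeff-scale c (a ∷ P) (suc k) = coeff-scale c P k

coeff-derivAux : ∀ m P k → coeff (derivAux m P) k ≡ + (m ℕ.+ k) * coeff P k
coeff-derivAux m []      k       = sym (ℤP.*-zeroʳ (+ (m ℕ.+ k)))
coeff-derivAux m (a ∷ P) zero    = cong (λ i → + i * a) (sym (ℕP.+-identityʳ m))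
coeff-derivAux m (a ∷ P) (suc k) = trans (coeff-derivAux (suc m) P k)
                                         (cong (λ i → + i * coeff P k) (sym (ℕP.+-suc m k)))

coeff-deriv : ∀ P k → coeff (deriv P) k ≡ + suc k * coeff P (suc k)
coeff-deriv []      k = sym (ℤP.*-zeroʳ (+ suc k))
coeff-deriv (a ∷ P) k = coeff-derivAux 1 P k

deriv-resp-≈ₚ : ∀ P Q → P ≈ₚ Q → deriv P ≈ₚ deriv Q
deriv-resp-≈ₚ P Q P≈Q k = begin
  coeff (deriv P) k          ≡⟨ coeff-deriv P k ⟩
  + suc k * coeff P (suc k)  ≡⟨ cong (λ v → + suc k * v) (P≈Q (suc k)) ⟩
  + suc k * coeff Q (suc k)  ≡⟨ coeff-deriv Q k ⟨
  coeff (deriv Q) k          ∎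

deriv-+ₚ : ∀ P Q → deriv (P +ₚ Q) ≈ₚ (deriv P +ₚ deriv Q)
deriv-+ₚ P Q k = begin
  coeff (deriv (P +ₚ Q)) k                                ≡⟨ coeff-deriv (P +ₚ Q) k ⟩
  + suc k * coeff (P +ₚ Q) (suc k)                        ≡⟨ cong (λ v → + suc k * v) (coeff-+ₚ P Q (suc k)) ⟩
  + suc k * (coeff P (suc k) + coeff Q (suc k))           ≡⟨ ℤP.*-distribˡ-+ (+ suc k) (coeff P (suc k)) _ ⟩
  + suc k * coeff P (suc k) + + suc k * coeff Q (suc k)   ≡⟨ cong₂ _+_ (coeff-deriv P k) (coeff-deriv Q k) ⟨
  coeff (deriv P) k + coeff (deriv Q) k                   ≡⟨ coeff-+ₚ (deriv P) (deriv Q) k ⟨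
  coeff (deriv P +ₚ deriv Q) k                            ∎

deriv-scale : ∀ c P → deriv (scale c P) ≈ₚ scale c (deriv P)
deriv-scale c P k = begin
  coeff (deriv (scale c P)) k          ≡⟨ coeff-deriv (scale c P) k ⟩
  + suc k * coeff (scale c P) (suc k)  ≡⟨ cong (λ v → + suc k * v) (coeff-scale c P (suc k)) ⟩
  + suc k * (c * coeff P (suc k))      ≡⟨ swap (+ suc k) c _ ⟩
  c * (+ suc k * coeff P (suc k))      ≡⟨ cong (c *_) (coeff-deriv P k) ⟨
  c * coeff (deriv P) k                ≡⟨ coeff-scale c (deriv P) k ⟨
  coeff (scale c (deriv P)) k          ∎
  where
  swap : ∀ a b x → a * (b * x) ≡ b * (a * x)
  swap = solve-∀

eval′ : Poly → ℤ → ℤ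
eval′ P = eval (deriv P)

eval″ : Poly → ℤ → ℤ
eval″ P = eval′ (deriv P)

eval′-resp-≈ₚ : ∀ P Q → P ≈ₚ Q → ∀ t → eval′ P t ≡ eval′ Q t
eval′-resp-≈ₚ P Q P≈Q = eval-resp-≈ₚ (deriv P) (deriv Q) (deriv-resp-≈ₚ P Q P≈Q)

eval′-+ₚ : ∀ P Q t → eval′ (P +ₚ Q) t ≡ eval′ P t + eval′ Q t
eval′-+ₚ P Q t = trans (eval-resp-≈ₚ (deriv (P +ₚ Q)) (deriv P +ₚ deriv Q) (deriv-+ₚ P Q) t) (eval-+ₚ (deriv P) (deriv Q) t)

eval′-scale : ∀ c P t → eval′ (scale c P) t ≡ c * eval′ P t
eval′-scale c P t = trans (eval-resp-≈ₚ (deriv (scale c P)) (scale c (deriv P)) (deriv-scale c P) t) (eval-scale c (deriv P) t)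

eval-derivAux-suc : ∀ m R t → eval (derivAux (suc m) R) t ≡ eval (derivAux m R) t + eval R t
eval-derivAux-suc m []      t = refl
eval-derivAux-suc m (r ∷ R) t = begin
  (+ suc m) * r + t * eval (derivAux (suc (suc m)) R) t                   ≡⟨ cong (λ v → + suc m * r + t * v) (eval-derivAux-suc (suc m) R t) ⟩
  (+ suc m) * r + t * (eval (derivAux (suc m) R) t + eval R t)            ≡⟨ regroup (+ m) r t _ _ ⟩
  + m * r + t * eval (derivAux (suc m) R) t + (r + t * eval R t)          ∎
  where
  regroup : ∀ m r t u v → (1ℤ + m) * r + t * (u + v) ≡ m * r + t * u + (r + t * v)
  regroup = solve-∀

eval-derivAux-zero : ∀ R t → eval (derivAux 0 R) t ≡ t * eval′ R t
eval-derivAux-zero []      t = sym (ℤP.*-zeroʳ t)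
eval-derivAux-zero (r ∷ R) t = ℤP.+-identityˡ _

eval′-∷ : ∀ a P t → eval′ (a ∷ P) t ≡ eval P t + t * eval′ P t
eval′-∷ a P t = begin
  eval (derivAux 1 P) t               ≡⟨ eval-derivAux-suc 0 P t ⟩
  eval (derivAux 0 P) t + eval P t    ≡⟨ cong (_+ eval P t) (eval-derivAux-zero P t) ⟩
  t * eval′ P t + eval P t            ≡⟨ ℤP.+-comm _ (eval P t) ⟩
  eval P t + t * eval′ P t            ∎

eval′-*ₚ : ∀ P Q t → eval′ (P *ₚ Q) t ≡ eval′ P t * eval Q t + eval P t * eval′ Q t
eval′-*ₚ []      Q t = sym (trans (cong (_+ 0ℤ * eval′ Q t) (ℤP.*-zeroˡ (eval Q t))) refl)
eval′-*ₚ (a ∷ P) Q t = begin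
  eval′ (scale a Q +ₚ (0ℤ ∷ (P *ₚ Q))) t                               ≡⟨ eval′-+ₚ (scale a Q) _ t ⟩
  eval′ (scale a Q) t + eval′ (0ℤ ∷ (P *ₚ Q)) t                        ≡⟨ cong₂ _+_ (eval′-scale a Q t) (eval′-∷ 0ℤ (P *ₚ Q) t) ⟩
  a * Q′ + (eval (P *ₚ Q) t + t * eval′ (P *ₚ Q) t)                   ≡⟨ cong₂ (λ u v → a * Q′ + (u + t * v)) (eval-*ₚ P Q t) (eval′-*ₚ P Q t) ⟩
  a * Q′ + (eval P t * Q₀ + t * (eval′ P t * Q₀ + eval P t * Q′))    ≡⟨ regroup a t (eval P t) (eval′ P t) Q₀ Q′ ⟩
  (eval P t + t * eval′ P t) * Q₀ + (a + t * eval P t) * Q′          ≡⟨ cong (λ v → v * Q₀ + (a + t * eval P t) * Q′) (eval′-∷ a P t) ⟨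
  eval′ (a ∷ P) t * Q₀ + eval (a ∷ P) t * Q′                         ∎
  where
  Q₀ = eval Q t
  Q′ = eval′ Q t
  regroup : ∀ a t p p′ q q′ → a * q′ + (p * q + t * (p′ * q + p * q′)) ≡ (p + t * p′) * q + (a + t * p) * q′
  regroup = solve-∀

deriv-*ₚ : ∀ P Q → deriv (P *ₚ Q) ≈ₚ ((deriv P *ₚ Q) +ₚ (P *ₚ deriv Q))
deriv-*ₚ P Q = eval-≗⇒≈ₚ (deriv (P *ₚ Q)) ((deriv P *ₚ Q) +ₚ (P *ₚ deriv Q)) λ t → begin
  eval′ (P *ₚ Q) t                                          ≡⟨ eval′-*ₚ P Q t ⟩
  eval′ P t * eval Q t + eval P t * eval′ Q t               ≡⟨ cong₂ _+_ (eval-*ₚ (deriv P) Q t) (eval-*ₚ P (deriv Q) t) ⟨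
  eval (deriv P *ₚ Q) t + eval (P *ₚ deriv Q) t             ≡⟨ eval-+ₚ (deriv P *ₚ Q) _ t ⟨
  eval ((deriv P *ₚ Q) +ₚ (P *ₚ deriv Q)) t                 ∎

eval″-*ₚ : ∀ P Q t → eval″ (P *ₚ Q) t ≡ eval″ P t * eval Q t + + 2 * (eval′ P t * eval′ Q t) + eval P t * eval″ Q t
eval″-*ₚ P Q t = begin
  eval′ (deriv (P *ₚ Q)) t                                          ≡⟨ eval′-resp-≈ₚ (deriv (P *ₚ Q)) ((deriv P *ₚ Q) +ₚ (P *ₚ deriv Q)) (deriv-*ₚ P Q) t ⟩
  eval′ ((deriv P *ₚ Q) +ₚ (P *ₚ deriv Q)) t                        ≡⟨ eval′-+ₚ (deriv P *ₚ Q) _ t ⟩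
  eval′ (deriv P *ₚ Q) t + eval′ (P *ₚ deriv Q) t                   ≡⟨ cong₂ _+_ (eval′-*ₚ (deriv P) Q t) (eval′-*ₚ P (deriv Q) t) ⟩
  (eval″ P t * eval Q t + eval′ P t * eval′ Q t) + (eval′ P t * eval′ Q t + eval P t * eval″ Q t)
                                                                    ≡⟨ regroup (eval″ P t) (eval Q t) (eval′ P t * eval′ Q t) _ ⟩
  eval″ P t * eval Q t + + 2 * (eval′ P t * eval′ Q t) + eval P t * eval″ Q t ∎
  where
  regroup : ∀ a b m c → (a * b + m) + (m + c) ≡ a * b + + 2 * m + c
  regroup = solve-∀

-- Factorisations into linear factors

record Factorisation (p : Poly) (c : ℤ) (xs : List ℤ) : Set where
  constructor factorised
  field ≈ₚ-factors : p ≈ₚ (constP c *ₚ prodLin xs)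

coeff-constP-*ₚ : ∀ c P k → coeff (constP c *ₚ P) k ≡ c * coeff P k
coeff-constP-*ₚ c P k = begin
  coeff (scale c P +ₚ (0ℤ ∷ [])) k        ≡⟨ coeff-+ₚ (scale c P) (0ℤ ∷ []) k ⟩
  coeff (scale c P) k + coeff (0ℤ ∷ []) k ≡⟨ cong₂ _+_ (coeff-scale c P k) (coeff-zero k) ⟩
  c * coeff P k + 0ℤ                      ≡⟨ ℤP.+-identityʳ _ ⟩
  c * coeff P k                           ∎
  where
  coeff-zero : ∀ k → coeff (0ℤ ∷ []) k ≡ 0ℤ
  coeff-zero zero    = refl
  coeff-zero (suc k) = refl

coeff-lin-*ₚ : ∀ x Q k → coeff (lin x *ₚ Q) (suc k) ≡ - x * coeff Q (suc k) + coeff Q k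
coeff-lin-*ₚ x Q k = begin
  coeff (scale (- x) Q +ₚ (0ℤ ∷ (constP 1ℤ *ₚ Q))) (suc k)   ≡⟨ coeff-+ₚ (scale (- x) Q) _ (suc k) ⟩
  coeff (scale (- x) Q) (suc k) + coeff (constP 1ℤ *ₚ Q) k   ≡⟨ cong₂ _+_ (coeff-scale (- x) Q (suc k)) (coeff-constP-*ₚ 1ℤ Q k) ⟩
  - x * coeff Q (suc k) + 1ℤ * coeff Q k                     ≡⟨ cong (λ v → - x * coeff Q (suc k) + v) (ℤP.*-identityˡ (coeff Q k)) ⟩
  - x * coeff Q (suc k) + coeff Q k                          ∎

coeff-prodLin->length : ∀ xs k → length xs < k → coeff (prodLin xs) k ≡ 0ℤ
coeff-prodLin->length []       (suc k) _               = refl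
coeff-prodLin->length (x ∷ xs) (suc k) (ℕ.s≤s |xs|<k) = begin
  coeff (lin x *ₚ prodLin xs) (suc k)                        ≡⟨ coeff-lin-*ₚ x (prodLin xs) k ⟩
  - x * coeff (prodLin xs) (suc k) + coeff (prodLin xs) k    ≡⟨ cong₂ (λ u v → - x * u + v)
                                                                  (coeff-prodLin->length xs (suc k) (ℕP.m≤n⇒m≤1+n |xs|<k))
                                                                  (coeff-prodLin->length xs k |xs|<k) ⟩
  - x * 0ℤ + 0ℤ                                              ≡⟨ trans (ℤP.+-identityʳ _) (ℤP.*-zeroʳ (- x)) ⟩
  0ℤ                                                         ∎

coeff-prodLin-length : ∀ xs → coeff (prodLin xs) (length xs) ≡ 1ℤ
coeff-prodLin-length []       = refl
coeff-prodLin-length (x ∷ xs) = begin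
  coeff (lin x *ₚ prodLin xs) (suc (length xs))                                 ≡⟨ coeff-lin-*ₚ x (prodLin xs) (length xs) ⟩
  - x * coeff (prodLin xs) (suc (length xs)) + coeff (prodLin xs) (length xs)   ≡⟨ cong₂ (λ u v → - x * u + v)
                                                                                     (coeff-prodLin->length xs _ ℕP.≤-refl)
                                                                                     (coeff-prodLin-length xs) ⟩
  - x * 0ℤ + 1ℤ                                                                 ≡⟨ cong (_+ 1ℤ) (ℤP.*-zeroʳ (- x)) ⟩
  1ℤ                                                                            ∎

factorisation-degree : ∀ {p d c xs} → HasDegree p d → Factorisation p c xs →
                       c ≢ 0ℤ × length xs ≡ d × coeff p d ≡ c
factorisation-degree {p} {d} {c} {xs} (lead≢0 , above≡0) (factorised p≈cxs) = c≢0 , |xs|≡d , lead≡c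
  where
  coeff-p : ∀ k → coeff p k ≡ c * coeff (prodLin xs) k
  coeff-p k = trans (p≈cxs k) (coeff-constP-*ₚ c (prodLin xs) k)
  c≢0 : c ≢ 0ℤ
  c≢0 c≡0 = lead≢0 (trans (coeff-p d) (cong (_* coeff (prodLin xs) d) c≡0))
  coeff-p-length : coeff p (length xs) ≡ c
  coeff-p-length = trans (coeff-p (length xs)) (trans (cong (c *_) (coeff-prodLin-length xs)) (ℤP.*-identityʳ c))
  |xs|≡d : length xs ≡ d
  |xs|≡d with ℕP.<-cmp (length xs) d
  ... | tri≈ _ |xs|≡d _ = |xs|≡d
  ... | tri< |xs|<d _ _ = contradiction
    (trans (coeff-p d) (trans (cong (c *_) (coeff-prodLin->length xs d |xs|<d)) (ℤP.*-zeroʳ c))) lead≢0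
  ... | tri> _ _ |xs|>d = contradiction (trans (sym coeff-p-length) (above≡0 (length xs) |xs|>d)) c≢0
  lead≡c : coeff p d ≡ c
  lead≡c = trans (cong (coeff p) (sym |xs|≡d)) coeff-p-length

eval-factorisation : ∀ {p c xs} → Factorisation p c xs → ∀ t → eval p t ≡ c * linProd xs t
eval-factorisation {p} {c} {xs} (factorised p≈cxs) t = begin
  eval p t                          ≡⟨ eval-resp-≈ₚ p (constP c *ₚ prodLin xs) p≈cxs t ⟩
  eval (constP c *ₚ prodLin xs) t   ≡⟨ eval-constP-*ₚ c (prodLin xs) t ⟩
  c * eval (prodLin xs) t           ≡⟨ cong (c *_) (eval-prodLin xs t) ⟩
  c * linProd xs t                  ∎

eval′-factorisation : ∀ {p c xs} → Factorisation p c xs → ∀ t → eval′ p t ≡ c * eval′ (prodLin xs) t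
eval′-factorisation {p} {c} {xs} (factorised p≈cxs) t = begin
  eval′ p t                                                       ≡⟨ eval′-resp-≈ₚ p (constP c *ₚ prodLin xs) p≈cxs t ⟩
  eval′ (constP c *ₚ prodLin xs) t                                ≡⟨ eval′-*ₚ (constP c) (prodLin xs) t ⟩
  0ℤ + eval (constP c) t * eval′ (prodLin xs) t                   ≡⟨ ℤP.+-identityˡ _ ⟩
  eval (constP c) t * eval′ (prodLin xs) t                        ≡⟨ cong (_* eval′ (prodLin xs) t) (eval-constP c t) ⟩
  c * eval′ (prodLin xs) t                                        ∎

eval″-factorisation : ∀ {p c xs} → Factorisation p c xs → ∀ t → eval″ p t ≡ c * eval″ (prodLin xs) t
eval″-factorisation {p} {c} {xs} (factorised p≈cxs) t = begin
  eval″ p t                                                       ≡⟨ eval′-resp-≈ₚ (deriv p) (deriv (constP c *ₚ prodLin xs)) (deriv-resp-≈ₚ p (constP c *ₚ prodLin xs) p≈cxs) t ⟩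
  eval″ (constP c *ₚ prodLin xs) t                                ≡⟨ eval″-*ₚ (constP c) (prodLin xs) t ⟩
  0ℤ + + 2 * 0ℤ + eval (constP c) t * eval″ (prodLin xs) t        ≡⟨ ℤP.+-identityˡ _ ⟩
  eval (constP c) t * eval″ (prodLin xs) t                        ≡⟨ cong (_* eval″ (prodLin xs) t) (eval-constP c t) ⟩
  c * eval″ (prodLin xs) t                                        ∎

factorisation-≗ : ∀ {p c xs ys} → (∀ t → linProd xs t ≡ linProd ys t) →
                  Factorisation p c xs → Factorisation p c ys
factorisation-≗ {p} {c} {xs} {ys} xs≗ys (factorised p≈cxs) = factorised λ k →
  trans (p≈cxs k) (eval-≗⇒≈ₚ (constP c *ₚ prodLin xs) (constP c *ₚ prodLin ys) same-values k)
  where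
  same-values : ∀ t → eval (constP c *ₚ prodLin xs) t ≡ eval (constP c *ₚ prodLin ys) t
  same-values t = begin
    eval (constP c *ₚ prodLin xs) t   ≡⟨ eval-constP-*ₚ c (prodLin xs) t ⟩
    c * eval (prodLin xs) t           ≡⟨ cong (c *_) (trans (eval-prodLin xs t) (trans (xs≗ys t) (sym (eval-prodLin ys t)))) ⟩
    c * eval (prodLin ys) t           ≡⟨ eval-constP-*ₚ c (prodLin ys) t ⟨
    eval (constP c *ₚ prodLin ys) t   ∎

HasDegree-deriv : ∀ {p d} → HasDegree p (suc d) → HasDegree (deriv p) d
HasDegree-deriv {p} {d} (lead≢0 , above≡0) = lead′≢0 , above′≡0
  where
  lead′≢0 : coeff (deriv p) d ≢ 0ℤ
  lead′≢0 lead′≡0 = lead≢0 (*-≡0⇒≡0 (+ suc d) (λ ()) (trans (sym (coeff-deriv p d)) lead′≡0))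
  above′≡0 : ∀ k → d < k → coeff (deriv p) k ≡ 0ℤ
  above′≡0 k d<k = trans (coeff-deriv p k) (trans (cong (+ suc k *_) (above≡0 (suc k) (ℕ.s≤s d<k))) (ℤP.*-zeroʳ (+ suc k)))

eval′-prodLin-∷ : ∀ x xs t → eval′ (prodLin (x ∷ xs)) t ≡ linProd xs t + (t - x) * eval′ (prodLin xs) t
eval′-prodLin-∷ x xs t = begin
  eval′ (lin x *ₚ prodLin xs) t                                            ≡⟨ eval′-*ₚ (lin x) (prodLin xs) t ⟩
  eval′ (lin x) t * eval (prodLin xs) t + eval (lin x) t * eval′ (prodLin xs) t
                                                                           ≡⟨ cong₂ (λ u v → u * eval (prodLin xs) t + v * eval′ (prodLin xs) t)
                                                                                (eval-constP 1ℤ t) (eval-lin x t) ⟩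
  1ℤ * eval (prodLin xs) t + (t - x) * eval′ (prodLin xs) t                ≡⟨ cong (_+ (t - x) * eval′ (prodLin xs) t)
                                                                                (trans (ℤP.*-identityˡ _) (eval-prodLin xs t)) ⟩
  linProd xs t + (t - x) * eval′ (prodLin xs) t                            ∎

eval″-prodLin-∷ : ∀ x xs t → eval″ (prodLin (x ∷ xs)) t ≡ + 2 * eval′ (prodLin xs) t + (t - x) * eval″ (prodLin xs) t
eval″-prodLin-∷ x xs t = begin
  eval″ (lin x *ₚ prodLin xs) t                                                      ≡⟨ eval″-*ₚ (lin x) (prodLin xs) t ⟩
  0ℤ + + 2 * (eval′ (lin x) t * eval′ (prodLin xs) t) + eval (lin x) t * eval″ (prodLin xs) t
                                                                                     ≡⟨ cong₂ (λ u v → 0ℤ + + 2 * (u * eval′ (prodLin xs) t) + v * eval″ (prodLin xs) t)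
                                                                                          (eval-constP 1ℤ t) (eval-lin x t) ⟩
  0ℤ + + 2 * (1ℤ * eval′ (prodLin xs) t) + (t - x) * eval″ (prodLin xs) t            ≡⟨ simplify (eval′ (prodLin xs) t) ((t - x) * eval″ (prodLin xs) t) ⟩
  + 2 * eval′ (prodLin xs) t + (t - x) * eval″ (prodLin xs) t                        ∎
  where
  simplify : ∀ a b → 0ℤ + + 2 * (1ℤ * a) + b ≡ + 2 * a + b
  simplify = solve-∀

linProd-root : ∀ xs t → linProd xs t ≡ 0ℤ →
               ∃[ ys ] length xs ≡ suc (length ys) × (∀ s → linProd xs s ≡ (s - t) * linProd ys s)
linProd-root (x ∷ xs) t x∷xs[t]≡0 with ℤP.i*j≡0⇒i≡0∨j≡0 (t - x) x∷xs[t]≡0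
... | inj₁ t-x≡0 = xs , refl , λ s → cong (λ v → (s - v) * linProd xs s) (sym (ℤP.i-j≡0⇒i≡j t x t-x≡0))
... | inj₂ xs[t]≡0 with linProd-root xs t xs[t]≡0
...   | ys , |xs|≡1+|ys| , xs≗ = x ∷ ys , cong suc |xs|≡1+|ys| , λ s → begin
  (s - x) * linProd xs s              ≡⟨ cong ((s - x) *_) (xs≗ s) ⟩
  (s - x) * ((s - t) * linProd ys s)  ≡⟨ swap (s - x) (s - t) _ ⟩
  (s - t) * ((s - x) * linProd ys s)  ∎
  where
  swap : ∀ a b c → a * (b * c) ≡ b * (a * c)
  swap = solve-∀

linProd-shift : ∀ C xs a → linProd xs (C + a) ≡ linProd (map (λ x → x - C) xs) a
linProd-shift C []       a = refl
linProd-shift C (x ∷ xs) a = cong₂ _*_ (shift C x a) (linProd-shift C xs a)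
  where
  shift : ∀ C x a → C + a - x ≡ a - (x - C)
  shift = solve-∀

EvenAbout : ℤ → (ℤ → ℤ) → Set
EvenAbout C f = ∀ a → f (C - a) ≡ f (C + a)

OddAbout : ℤ → (ℤ → ℤ) → Set
OddAbout C f = ∀ a → f (C - a) ≡ - f (C + a)

OddAbout⇒centre≡0 : ∀ {C f} → OddAbout C f → f C ≡ 0ℤ
OddAbout⇒centre≡0 {C} {f} odd = i≡-i⇒i≡0 (begin
  f C            ≡⟨ cong f (ℤP.+-identityʳ C) ⟨
  f (C - 0ℤ)     ≡⟨ odd 0ℤ ⟩
  - f (C + 0ℤ)   ≡⟨ cong (λ v → - f v) (ℤP.+-identityʳ C) ⟩
  - f C          ∎)

reflect : Poly → Poly
reflect []      = []
reflect (a ∷ P) = a ∷ scale -1ℤ (reflect P)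

eval-reflect : ∀ P t → eval (reflect P) t ≡ eval P (- t)
eval-reflect []      t = refl
eval-reflect (a ∷ P) t = begin
  a + t * eval (scale -1ℤ (reflect P)) t ≡⟨ cong (λ v → a + t * v) (eval-scale -1ℤ (reflect P) t) ⟩
  a + t * (-1ℤ * eval (reflect P) t)     ≡⟨ cong (λ v → a + t * (-1ℤ * v)) (eval-reflect P t) ⟩
  a + t * (-1ℤ * eval P (- t))           ≡⟨ move-sign a t (eval P (- t)) ⟩
  a + - t * eval P (- t)                 ∎
  where
  move-sign : ∀ a t x → a + t * (-1ℤ * x) ≡ a + - t * x
  move-sign = solve-∀

EvenAbout-from-large : ∀ N C xs → (∀ n → N < n → linProd xs (C - + n) ≡ linProd xs (C + + n)) →
                       EvenAbout C (linProd xs)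
EvenAbout-from-large N C xs large a = begin
  linProd xs (C - a)      ≡⟨ eval-P (- a) ⟩
  eval P (- a)            ≡⟨ eval-reflect P a ⟨
  eval (reflect P) a      ≡⟨ eval-resp-≈ₚ (reflect P) P (eval-agree⇒≈ₚ N (reflect P) P reflect-agrees) a ⟩
  eval P a                ≡⟨ eval-P a ⟨
  linProd xs (C + a)      ∎
  where
  P = prodLin (map (λ x → x - C) xs)
  eval-P : ∀ t → linProd xs (C + t) ≡ eval P t
  eval-P t = trans (linProd-shift C xs t) (sym (eval-prodLin (map (λ x → x - C) xs) t))
  reflect-agrees : ∀ n → N < n → eval (reflect P) (+ n) ≡ eval P (+ n)
  reflect-agrees n N<n = begin
    eval (reflect P) (+ n)   ≡⟨ eval-reflect P (+ n) ⟩
    eval P (- + n)           ≡⟨ eval-P (- + n) ⟨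
    linProd xs (C - + n)     ≡⟨ large n N<n ⟩
    linProd xs (C + + n)     ≡⟨ eval-P (+ n) ⟩
    eval P (+ n)             ∎

-- Roots placed symmetrically about a centre

mirrorPairs : ℤ → List ℤ → List ℤ
mirrorPairs C []      = []
mirrorPairs C (w ∷ W) = C + w ∷ C - w ∷ mirrorPairs C W

linProd-mirrorPairs-even : ∀ C W → EvenAbout C (linProd (mirrorPairs C W))
linProd-mirrorPairs-even C []      a = refl
linProd-mirrorPairs-even C (w ∷ W) a = begin
  ((C - a) - (C + w)) * (((C - a) - (C - w)) * linProd L (C - a))
    ≡⟨ cong (λ v → ((C - a) - (C + w)) * (((C - a) - (C - w)) * v)) (linProd-mirrorPairs-even C W a) ⟩
  ((C - a) - (C + w)) * (((C - a) - (C - w)) * linProd L (C + a))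
    ≡⟨ pair-even C a w (linProd L (C + a)) ⟩
  ((C + a) - (C + w)) * (((C + a) - (C - w)) * linProd L (C + a)) ∎
  where
  L = mirrorPairs C W
  pair-even : ∀ C a w X → ((C - a) - (C + w)) * (((C - a) - (C - w)) * X) ≡ ((C + a) - (C + w)) * (((C + a) - (C - w)) * X)
  pair-even = solve-∀

eval′-prodLin-pair : ∀ a b R t → eval′ (prodLin (a ∷ b ∷ R)) t ≡
                     (t - b) * linProd R t + (t - a) * (linProd R t + (t - b) * eval′ (prodLin R) t)
eval′-prodLin-pair a b R t = trans (eval′-prodLin-∷ a (b ∷ R) t)
  (cong (λ v → (t - b) * linProd R t + (t - a) * v) (eval′-prodLin-∷ b R t))

eval″-prodLin-pair : ∀ a b R t → eval″ (prodLin (a ∷ b ∷ R)) t ≡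
                     + 2 * (linProd R t + (t - b) * eval′ (prodLin R) t) + (t - a) * (+ 2 * eval′ (prodLin R) t + (t - b) * eval″ (prodLin R) t)
eval″-prodLin-pair a b R t = trans (eval″-prodLin-∷ a (b ∷ R) t)
  (cong₂ (λ u v → + 2 * u + (t - a) * v) (eval′-prodLin-∷ b R t) (eval″-prodLin-∷ b R t))

eval′-mirrorPairs-odd : ∀ C W → OddAbout C (eval′ (prodLin (mirrorPairs C W)))
eval′-mirrorPairs-odd C []      a = refl
eval′-mirrorPairs-odd C (w ∷ W) a = begin
  eval′ (prodLin (C + w ∷ C - w ∷ L)) (C - a)
    ≡⟨ eval′-prodLin-pair (C + w) (C - w) L (C - a) ⟩
  ((C - a) - (C - w)) * linProd L (C - a) + ((C - a) - (C + w)) * (linProd L (C - a) + ((C - a) - (C - w)) * eval′ (prodLin L) (C - a))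
    ≡⟨ cong₂ (λ u v → ((C - a) - (C - w)) * u + ((C - a) - (C + w)) * (u + ((C - a) - (C - w)) * v))
         (linProd-mirrorPairs-even C W a) (eval′-mirrorPairs-odd C W a) ⟩
  ((C - a) - (C - w)) * X + ((C - a) - (C + w)) * (X + ((C - a) - (C - w)) * - Y)
    ≡⟨ pair-odd C a w X Y ⟩
  - (((C + a) - (C - w)) * X + ((C + a) - (C + w)) * (X + ((C + a) - (C - w)) * Y))
    ≡⟨ cong -_ (eval′-prodLin-pair (C + w) (C - w) L (C + a)) ⟨
  - eval′ (prodLin (C + w ∷ C - w ∷ L)) (C + a) ∎
  where
  L = mirrorPairs C W
  X = linProd L (C + a)
  Y = eval′ (prodLin L) (C + a)
  pair-odd : ∀ C a w X Y →
    ((C - a) - (C - w)) * X + ((C - a) - (C + w)) * (X + ((C - a) - (C - w)) * - Y) ≡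
    - (((C + a) - (C - w)) * X + ((C + a) - (C + w)) * (X + ((C + a) - (C - w)) * Y))
  pair-odd = solve-∀

eval″-mirrorPairs-even : ∀ C W → EvenAbout C (eval″ (prodLin (mirrorPairs C W)))
eval″-mirrorPairs-even C []      a = refl
eval″-mirrorPairs-even C (w ∷ W) a = begin
  eval″ (prodLin (C + w ∷ C - w ∷ L)) (C - a)
    ≡⟨ eval″-prodLin-pair (C + w) (C - w) L (C - a) ⟩
  + 2 * (linProd L (C - a) + ((C - a) - (C - w)) * eval′ (prodLin L) (C - a))
    + ((C - a) - (C + w)) * (+ 2 * eval′ (prodLin L) (C - a) + ((C - a) - (C - w)) * eval″ (prodLin L) (C - a))
    ≡⟨ cong₃ (λ u v z → + 2 * (u + ((C - a) - (C - w)) * v) + ((C - a) - (C + w)) * (+ 2 * v + ((C - a) - (C - w)) * z))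
         (linProd-mirrorPairs-even C W a) (eval′-mirrorPairs-odd C W a) (eval″-mirrorPairs-even C W a) ⟩
  + 2 * (X + ((C - a) - (C - w)) * - Y) + ((C - a) - (C + w)) * (+ 2 * - Y + ((C - a) - (C - w)) * Z)
    ≡⟨ pair-even C a w X Y Z ⟩
  + 2 * (X + ((C + a) - (C - w)) * Y) + ((C + a) - (C + w)) * (+ 2 * Y + ((C + a) - (C - w)) * Z)
    ≡⟨ eval″-prodLin-pair (C + w) (C - w) L (C + a) ⟨
  eval″ (prodLin (C + w ∷ C - w ∷ L)) (C + a) ∎
  where
  L = mirrorPairs C W
  X = linProd L (C + a)
  Y = eval′ (prodLin L) (C + a)
  Z = eval″ (prodLin L) (C + a)
  pair-even : ∀ C a w X Y Z →
    + 2 * (X + ((C - a) - (C - w)) * - Y) + ((C - a) - (C + w)) * (+ 2 * - Y + ((C - a) - (C - w)) * Z) ≡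
    + 2 * (X + ((C + a) - (C - w)) * Y) + ((C + a) - (C + w)) * (+ 2 * Y + ((C + a) - (C - w)) * Z)
  pair-even = solve-∀

linProd-mirrorPairs-centre : ∀ C W → linProd (mirrorPairs C W) C ≡ -1ℤ ^ length W * (∏ W * ∏ W)
linProd-mirrorPairs-centre C []      = refl
linProd-mirrorPairs-centre C (w ∷ W) = begin
  (C - (C + w)) * ((C - (C - w)) * linProd (mirrorPairs C W) C)    ≡⟨ cong (λ v → (C - (C + w)) * ((C - (C - w)) * v))
                                                                         (linProd-mirrorPairs-centre C W) ⟩
  (C - (C + w)) * ((C - (C - w)) * (-1ℤ ^ length W * (∏ W * ∏ W))) ≡⟨ pair-at-centre C w (-1ℤ ^ length W) (∏ W) ⟩
  -1ℤ * -1ℤ ^ length W * ((w * ∏ W) * (w * ∏ W))                   ∎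
  where
  pair-at-centre : ∀ C w g A → (C - (C + w)) * ((C - (C - w)) * (g * (A * A))) ≡ -1ℤ * g * ((w * A) * (w * A))
  pair-at-centre = solve-∀

eval′-mirrorPairs-centre : ∀ C W → eval′ (prodLin (mirrorPairs C W)) C ≡ 0ℤ
eval′-mirrorPairs-centre C W = OddAbout⇒centre≡0 {C} {eval′ (prodLin (mirrorPairs C W))} (eval′-mirrorPairs-odd C W)

-- 2 Σᵢ ∏_{j ≠ i} wⱼ², which is ± p''(C)/c for p = c ∏ᵢ ((x − C)² − wᵢ²).
cofactorSquareSum : List ℤ → ℕ
cofactorSquareSum []      = 0
cofactorSquareSum (w ∷ W) = 2 ℕ.* (∣ ∏ W ∣ ℕ.* ∣ ∏ W ∣) ℕ.+ (∣ w ∣ ℕ.* ∣ w ∣) ℕ.* cofactorSquareSum W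

cofactorSquareSum-≢0 : ∀ w W → ∏ W ≢ 0ℤ → cofactorSquareSum (w ∷ W) ≢ 0
cofactorSquareSum-≢0 w W ∏W≢0 css≡0 with ℕP.m*n≡0⇒m≡0∨n≡0 2 (ℕP.m+n≡0⇒m≡0 (2 ℕ.* (∣ ∏ W ∣ ℕ.* ∣ ∏ W ∣)) css≡0)
... | inj₁ ()
... | inj₂ ∣∏W∣²≡0 = ∏W≢0 (ℤP.∣i∣≡0⇒i≡0 (reduce (ℕP.m*n≡0⇒m≡0∨n≡0 ∣ ∏ W ∣ ∣∏W∣²≡0)))

eval″-mirrorPairs-centre : ∀ C W → eval″ (prodLin (mirrorPairs C W)) C ≡ -1ℤ ^ length W * - + cofactorSquareSum W
eval″-mirrorPairs-centre C []      = refl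
eval″-mirrorPairs-centre C (w ∷ W) = begin
  eval″ (prodLin (C + w ∷ C - w ∷ L)) C
    ≡⟨ eval″-prodLin-pair (C + w) (C - w) L C ⟩
  + 2 * (linProd L C + (C - (C - w)) * eval′ (prodLin L) C) + (C - (C + w)) * (+ 2 * eval′ (prodLin L) C + (C - (C - w)) * eval″ (prodLin L) C)
    ≡⟨ cong₃ (λ u v z → + 2 * (u + (C - (C - w)) * v) + (C - (C + w)) * (+ 2 * v + (C - (C - w)) * z))
         (linProd-mirrorPairs-centre C W) (eval′-mirrorPairs-centre C W) (eval″-mirrorPairs-centre C W) ⟩
  + 2 * (g * (A * A) + (C - (C - w)) * 0ℤ) + (C - (C + w)) * (+ 2 * 0ℤ + (C - (C - w)) * (g * - + Q))
    ≡⟨ pair-at-centre C w g A (+ Q) ⟩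
  -1ℤ * g * - (+ 2 * (A * A) + (w * w) * + Q)
    ≡⟨ cong (λ v → -1ℤ * g * - v) as-natural ⟩
  -1ℤ * g * - + cofactorSquareSum (w ∷ W) ∎
  where
  L = mirrorPairs C W
  g = -1ℤ ^ length W
  A = ∏ W
  Q = cofactorSquareSum W
  pair-at-centre : ∀ C w g A Q →
    + 2 * (g * (A * A) + (C - (C - w)) * 0ℤ) + (C - (C + w)) * (+ 2 * 0ℤ + (C - (C - w)) * (g * - Q)) ≡
    -1ℤ * g * - (+ 2 * (A * A) + (w * w) * Q)
  pair-at-centre = solve-∀
  as-natural : + 2 * (A * A) + (w * w) * + Q ≡ + cofactorSquareSum (w ∷ W)
  as-natural = begin
    + 2 * (A * A) + (w * w) * + Q                                      ≡⟨ cong₂ (λ u v → + 2 * u + v * + Q) (i*i≡+∣i∣*∣i∣ A) (i*i≡+∣i∣*∣i∣ w) ⟩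
    + 2 * + (∣ A ∣ ℕ.* ∣ A ∣) + + (∣ w ∣ ℕ.* ∣ w ∣) * + Q              ≡⟨ cong₂ _+_ (ℤP.pos-* 2 (∣ A ∣ ℕ.* ∣ A ∣)) (ℤP.pos-* (∣ w ∣ ℕ.* ∣ w ∣) Q) ⟨
    + (2 ℕ.* (∣ A ∣ ℕ.* ∣ A ∣)) + + ((∣ w ∣ ℕ.* ∣ w ∣) ℕ.* Q)          ≡⟨ ℤP.pos-+ (2 ℕ.* (∣ A ∣ ℕ.* ∣ A ∣)) _ ⟨
    + cofactorSquareSum (w ∷ W)                                        ∎

linProd-∷-≢0 : ∀ x xs t → linProd (x ∷ xs) t ≢ 0ℤ → linProd xs t ≢ 0ℤ
linProd-∷-≢0 x xs t x∷xs≢0 xs≡0 = x∷xs≢0 (trans (cong ((t - x) *_) xs≡0) (ℤP.*-zeroʳ (t - x)))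

EvenAbout-drop-pair : ∀ C w ys → EvenAbout C (linProd (C + w ∷ C - w ∷ ys)) → EvenAbout C (linProd ys)
EvenAbout-drop-pair C w ys even = EvenAbout-from-large ∣ w ∣ C ys large
  where
  pair-value : ∀ C a w Y → (C + a - (C + w)) * ((C + a - (C - w)) * Y) ≡ (a - w) * (a + w) * Y
  pair-value = solve-∀
  pair-value′ : ∀ C a w Y → (C - a - (C + w)) * ((C - a - (C - w)) * Y) ≡ (a - w) * (a + w) * Y
  pair-value′ = solve-∀
  n-w≢0 : ∀ n → ∣ w ∣ < n → + n - w ≢ 0ℤ
  n-w≢0 n |w|<n n-w≡0 = ℕP.<-irrefl (cong ∣_∣ (sym (ℤP.i-j≡0⇒i≡j (+ n) w n-w≡0))) |w|<n
  n+w≢0 : ∀ n → ∣ w ∣ < n → + n + w ≢ 0ℤ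
  n+w≢0 n |w|<n n+w≡0 = ℕP.<-irrefl (trans (cong ∣_∣ w≡-n) (ℤP.∣-i∣≡∣i∣ (+ n))) |w|<n
    where
    w≡-n : w ≡ - + n
    w≡-n = ℤP.i-j≡0⇒i≡j w (- + n) (trans (rearrange (+ n) w) n+w≡0)
      where
      rearrange : ∀ n w → w - - n ≡ n + w
      rearrange = solve-∀
  large : ∀ n → ∣ w ∣ < n → linProd ys (C - + n) ≡ linProd ys (C + + n)
  large n |w|<n = *-cancelˡ-≢0 ((+ n - w) * (+ n + w)) (*-≢0 (n-w≢0 n |w|<n) (n+w≢0 n |w|<n)) (begin
    (+ n - w) * (+ n + w) * linProd ys (C - + n)   ≡⟨ pair-value′ C (+ n) w (linProd ys (C - + n)) ⟨
    linProd (C + w ∷ C - w ∷ ys) (C - + n)         ≡⟨ even (+ n) ⟩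
    linProd (C + w ∷ C - w ∷ ys) (C + + n)         ≡⟨ pair-value C (+ n) w (linProd ys (C + + n)) ⟩
    (+ n - w) * (+ n + w) * linProd ys (C + + n)   ∎)

-- The mirror image C − w of the root x = C + w is a root too, and it is not x itself since w ≠ 0.
split-off-mirror-pair : ∀ C x rest → EvenAbout C (linProd (x ∷ rest)) → linProd (x ∷ rest) C ≢ 0ℤ →
  ∃[ rest′ ] length rest ≡ suc (length rest′) ×
             (∀ s → linProd (x ∷ rest) s ≡ linProd (C + (x - C) ∷ C - (x - C) ∷ rest′) s)
split-off-mirror-pair C x rest even x∷rest[C]≢0 with linProd-root rest (C - w) mirror-is-root
  where
  w = x - C
  w≢0 : w ≢ 0ℤ
  w≢0 w≡0 = x∷rest[C]≢0 (trans (cong (_* linProd rest C) (trans (flip C x) (cong -_ w≡0))) (ℤP.*-zeroˡ (linProd rest C)))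
    where
    flip : ∀ C x → C - x ≡ - (x - C)
    flip = solve-∀
  mirror-is-root : linProd rest (C - w) ≡ 0ℤ
  mirror-is-root = *-≡0⇒≡0 ((C - w) - x) (λ e → w≢0 (*-≡0⇒≡0 (- + 2) (λ ()) (trans (twice C x) e))) (begin
    linProd (x ∷ rest) (C - w)     ≡⟨ even w ⟩
    (C + w - x) * linProd rest (C + w) ≡⟨ cong (_* linProd rest (C + w)) (cancel C x) ⟩
    0ℤ * linProd rest (C + w)      ≡⟨ ℤP.*-zeroˡ (linProd rest (C + w)) ⟩
    0ℤ                             ∎)
    where
    twice : ∀ C x → - + 2 * (x - C) ≡ C - (x - C) - x
    twice = solve-∀
    cancel : ∀ C x → C + (x - C) - x ≡ 0ℤ
    cancel = solve-∀
... | rest′ , |rest|≡1+|rest′| , rest≗ = rest′ , |rest|≡1+|rest′| , λ s →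
  cong₂ (λ u v → (s - u) * v) (recentre C x) (rest≗ s)
  where
  recentre : ∀ C x → x ≡ C + (x - C)
  recentre = solve-∀

mirror-pairing : ∀ C xs → EvenAbout C (linProd xs) → linProd xs C ≢ 0ℤ →
  ∃[ W ] length xs ≡ 2 ℕ.* length W × (∀ s → linProd xs s ≡ linProd (mirrorPairs C W) s)
mirror-pairing C xs = pair-up (length xs) xs ℕP.≤-refl
  where
  pair-up : ∀ n xs → length xs ≤ n → EvenAbout C (linProd xs) → linProd xs C ≢ 0ℤ →
    ∃[ W ] length xs ≡ 2 ℕ.* length W × (∀ s → linProd xs s ≡ linProd (mirrorPairs C W) s)
  pair-up _ [] _ _ _ = [] , refl , λ _ → refl
  pair-up (suc n) (x ∷ rest) (ℕ.s≤s |rest|≤n) even x∷rest[C]≢0 =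
    x - C ∷ W , length-pairs , λ s → trans (x∷rest≗ s) (cong (λ v → (s - (C + w)) * ((s - (C - w)) * v)) (rest′≗ s))
    where
    w = x - C
    split = split-off-mirror-pair C x rest even x∷rest[C]≢0
    rest′ = proj₁ split
    |rest|≡1+|rest′| = proj₁ (proj₂ split)
    x∷rest≗ = proj₂ (proj₂ split)
    even′ : EvenAbout C (linProd rest′)
    even′ = EvenAbout-drop-pair C w rest′ λ a → trans (sym (x∷rest≗ (C - a))) (trans (even a) (x∷rest≗ (C + a)))
    rest′[C]≢0 : linProd rest′ C ≢ 0ℤ
    rest′[C]≢0 = linProd-∷-≢0 (C - w) rest′ C (linProd-∷-≢0 (C + w) (C - w ∷ rest′) C
                   (λ e → x∷rest[C]≢0 (trans (x∷rest≗ C) e)))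
    pairs = pair-up n rest′ (ℕP.≤-trans (ℕP.n≤1+n _) (subst (_≤ n) |rest|≡1+|rest′| |rest|≤n)) even′ rest′[C]≢0
    W = proj₁ pairs
    rest′≗ = proj₂ (proj₂ pairs)
    length-pairs : suc (length rest) ≡ 2 ℕ.* suc (length W)
    length-pairs = trans (cong suc (trans |rest|≡1+|rest′| (cong suc (proj₁ (proj₂ pairs))))) (sym (ℕP.*-suc 2 (length W)))

eval′-centred-mirrorPairs-even : ∀ C W → EvenAbout C (eval′ (prodLin (C ∷ mirrorPairs C W)))
eval′-centred-mirrorPairs-even C W a = begin
  eval′ (prodLin (C ∷ L)) (C - a)                          ≡⟨ eval′-prodLin-∷ C L (C - a) ⟩
  linProd L (C - a) + (C - a - C) * eval′ (prodLin L) (C - a) ≡⟨ cong₂ (λ u v → u + (C - a - C) * v)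
                                                                   (linProd-mirrorPairs-even C W a) (eval′-mirrorPairs-odd C W a) ⟩
  linProd L (C + a) + (C - a - C) * - eval′ (prodLin L) (C + a) ≡⟨ flip-sign C a (linProd L (C + a)) (eval′ (prodLin L) (C + a)) ⟩
  linProd L (C + a) + (C + a - C) * eval′ (prodLin L) (C + a) ≡⟨ eval′-prodLin-∷ C L (C + a) ⟨
  eval′ (prodLin (C ∷ L)) (C + a)                          ∎
  where
  L = mirrorPairs C W
  flip-sign : ∀ C a X Y → X + (C - a - C) * - Y ≡ X + (C + a - C) * Y
  flip-sign = solve-∀

factor-root : ∀ {p c xs} C → c ≢ 0ℤ → Factorisation p c xs → eval p C ≡ 0ℤ →
              ∃[ xs′ ] length xs ≡ suc (length xs′) × Factorisation p c (C ∷ xs′)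
factor-root {p} {c} {xs} C c≢0 fac pC≡0 with
  linProd-root xs C (*-≡0⇒≡0 c c≢0 (trans (sym (eval-factorisation fac C)) pC≡0))
... | xs′ , |xs|≡1+|xs′| , xs≗ = xs′ , |xs|≡1+|xs′| , factorisation-≗ xs≗ fac

eval′-at-factored-root : ∀ {p c C xs} → Factorisation p c (C ∷ xs) → eval′ p C ≡ c * linProd xs C
eval′-at-factored-root {p} {c} {C} {xs} fac = begin
  eval′ p C                                              ≡⟨ eval′-factorisation fac C ⟩
  c * eval′ (prodLin (C ∷ xs)) C                         ≡⟨ cong (c *_) (eval′-prodLin-∷ C xs C) ⟩
  c * (linProd xs C + (C - C) * eval′ (prodLin xs) C)    ≡⟨ cong (λ v → c * (linProd xs C + v * eval′ (prodLin xs) C)) (ℤP.+-inverseʳ C) ⟩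
  c * (linProd xs C + 0ℤ)                                ≡⟨ cong (c *_) (ℤP.+-identityʳ (linProd xs C)) ⟩
  c * linProd xs C                                       ∎

double-root-divides : ∀ {p c xs} C → Factorisation p c (C ∷ xs) → linProd xs C ≡ 0ℤ → C ^ 2 ∣ₚ p
double-root-divides {p} {c} {xs} C fac xs[C]≡0 with linProd-root xs C xs[C]≡0
... | xs′ , _ , xs≗ = q , λ k → trans (Factorisation.≈ₚ-factors fac k) (eval-≗⇒≈ₚ (constP c *ₚ prodLin (C ∷ xs)) ((lin C ^ₚ 2) *ₚ q) same-values k)
  where
  q = constP c *ₚ prodLin xs′
  eval-lin² : ∀ t → eval (lin C ^ₚ 2) t ≡ (t - C) * ((t - C) * 1ℤ)
  eval-lin² t = trans (eval-*ₚ (lin C) (lin C ^ₚ 1) t) (cong₂ _*_ (eval-lin C t)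
                  (trans (eval-*ₚ (lin C) (constP 1ℤ) t) (cong₂ _*_ (eval-lin C t) (eval-constP 1ℤ t))))
  same-values : ∀ t → eval (constP c *ₚ prodLin (C ∷ xs)) t ≡ eval ((lin C ^ₚ 2) *ₚ q) t
  same-values t = begin
    eval (constP c *ₚ prodLin (C ∷ xs)) t                    ≡⟨ eval-constP-*ₚ c (prodLin (C ∷ xs)) t ⟩
    c * eval (prodLin (C ∷ xs)) t                            ≡⟨ cong (c *_) (eval-prodLin (C ∷ xs) t) ⟩
    c * ((t - C) * linProd xs t)                             ≡⟨ cong (λ v → c * ((t - C) * v)) (xs≗ t) ⟩
    c * ((t - C) * ((t - C) * linProd xs′ t))                ≡⟨ regroup c (t - C) (linProd xs′ t) ⟩
    (t - C) * ((t - C) * 1ℤ) * (c * linProd xs′ t)           ≡⟨ cong₂ _*_ (eval-lin² t) (trans (eval-constP-*ₚ c (prodLin xs′) t)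
                                                                  (cong (c *_) (eval-prodLin xs′ t))) ⟨
    eval (lin C ^ₚ 2) t * eval q t                           ≡⟨ eval-*ₚ (lin C ^ₚ 2) q t ⟨
    eval ((lin C ^ₚ 2) *ₚ q) t                               ∎
    where
    regroup : ∀ c u X → c * (u * (u * X)) ≡ u * (u * 1ℤ) * (c * X)
    regroup = solve-∀

OddAbout-centre-factor : ∀ {p c C xs} → c ≢ 0ℤ → Factorisation p c (C ∷ xs) → OddAbout C (eval p) →
                         EvenAbout C (linProd xs)
OddAbout-centre-factor {p} {c} {C} {xs} c≢0 fac odd a with a ℤ.≟ 0ℤ
... | yes refl = refl
... | no  a≢0  = *-cancelˡ-≢0 (c * - a) (*-≢0 c≢0 (λ -a≡0 → a≢0 (ℤP.neg-injective -a≡0))) (begin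
  c * - a * linProd xs (C - a)                ≡⟨ left c a C (linProd xs (C - a)) ⟩
  c * linProd (C ∷ xs) (C - a)                ≡⟨ eval-factorisation fac (C - a) ⟨
  eval p (C - a)                              ≡⟨ odd a ⟩
  - eval p (C + a)                            ≡⟨ cong -_ (eval-factorisation fac (C + a)) ⟩
  - (c * linProd (C ∷ xs) (C + a))            ≡⟨ right c a C (linProd xs (C + a)) ⟩
  c * - a * linProd xs (C + a)                ∎)
  where
  left : ∀ c a C X → c * - a * X ≡ c * ((C - a - C) * X)
  left = solve-∀
  right : ∀ c a C X → - (c * ((C + a - C) * X)) ≡ c * - a * X
  right = solve-∀

symmetric-factorisation : ∀ {p d c xs} C → HasDegree p d → Factorisation p c xs →
                          EvenAbout C (eval p) → eval p C ≢ 0ℤ →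
                          ∃[ W ] d ≡ 2 ℕ.* length W × Factorisation p c (mirrorPairs C W)
symmetric-factorisation {p} {d} {c} {xs} C deg fac even pC≢0 =
  W , trans (sym |xs|≡d) |xs|≡2|W| , factorisation-≗ xs≗ fac
  where
  c≢0 = proj₁ (factorisation-degree deg fac)
  |xs|≡d = proj₁ (proj₂ (factorisation-degree deg fac))
  even-xs : EvenAbout C (linProd xs)
  even-xs a = *-cancelˡ-≢0 c c≢0
    (trans (sym (eval-factorisation fac (C - a))) (trans (even a) (eval-factorisation fac (C + a))))
  xs[C]≢0 : linProd xs C ≢ 0ℤ
  xs[C]≢0 xs[C]≡0 = pC≢0 (trans (eval-factorisation fac C) (trans (cong (c *_) xs[C]≡0) (ℤP.*-zeroʳ c)))
  pairs = mirror-pairing C xs even-xs xs[C]≢0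
  W = proj₁ pairs
  |xs|≡2|W| = proj₁ (proj₂ pairs)
  xs≗ = proj₂ (proj₂ pairs)

antisymmetric-factorisation : ∀ {p d c xs} C → HasDegree p d → Factorisation p c xs →
                              OddAbout C (eval p) → eval′ p C ≢ 0ℤ →
                              ∃[ W ] d ≡ suc (2 ℕ.* length W) × Factorisation p c (C ∷ mirrorPairs C W)
antisymmetric-factorisation {p} {d} {c} {xs} C deg fac odd p′C≢0 =
  W , trans (sym |xs|≡d) (trans |xs|≡1+|xs′| (cong suc |xs′|≡2|W|)) ,
  factorisation-≗ (λ s → cong ((s - C) *_) (xs′≗ s)) fac′
  where
  c≢0 = proj₁ (factorisation-degree deg fac)
  |xs|≡d = proj₁ (proj₂ (factorisation-degree deg fac))
  root = factor-root C c≢0 fac (OddAbout⇒centre≡0 {C} {eval p} odd)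
  xs′ = proj₁ root
  |xs|≡1+|xs′| = proj₁ (proj₂ root)
  fac′ = proj₂ (proj₂ root)
  xs′[C]≢0 : linProd xs′ C ≢ 0ℤ
  xs′[C]≢0 xs′[C]≡0 = p′C≢0 (trans (eval′-at-factored-root fac′) (trans (cong (c *_) xs′[C]≡0) (ℤP.*-zeroʳ c)))
  pairs = mirror-pairing C xs′ (OddAbout-centre-factor c≢0 fac′ odd) xs′[C]≢0
  W = proj₁ pairs
  |xs′|≡2|W| = proj₁ (proj₂ pairs)
  xs′≗ = proj₂ (proj₂ pairs)

eval-mirrorPairs-centre : ∀ {p c} C W → Factorisation p c (mirrorPairs C W) →
                          eval p C ≡ c * (-1ℤ ^ length W * (∏ W * ∏ W))
eval-mirrorPairs-centre {c = c} C W fac = trans (eval-factorisation fac C) (cong (c *_) (linProd-mirrorPairs-centre C W))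

eval′-centred-mirrorPairs-centre : ∀ {p c} C W → Factorisation p c (C ∷ mirrorPairs C W) →
                                   eval′ p C ≡ c * (-1ℤ ^ length W * (∏ W * ∏ W))
eval′-centred-mirrorPairs-centre {c = c} C W fac =
  trans (eval′-at-factored-root fac) (cong (c *_) (linProd-mirrorPairs-centre C W))


mirror-factorisation⇒eval′-odd : ∀ {p c} C W → Factorisation p c (mirrorPairs C W) → OddAbout C (eval′ p)
mirror-factorisation⇒eval′-odd {p} {c} C W fac a = begin
  eval′ p (C - a)                                 ≡⟨ eval′-factorisation fac (C - a) ⟩
  c * eval′ (prodLin L) (C - a)                   ≡⟨ cong (c *_) (eval′-mirrorPairs-odd C W a) ⟩
  c * - eval′ (prodLin L) (C + a)                 ≡⟨ ℤP.neg-distribʳ-* c (eval′ (prodLin L) (C + a)) ⟨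
  - (c * eval′ (prodLin L) (C + a))               ≡⟨ cong -_ (eval′-factorisation fac (C + a)) ⟨
  - eval′ p (C + a)                               ∎
  where
  L = mirrorPairs C W

centred-mirror-factorisation⇒eval′-even : ∀ {p c} C W → Factorisation p c (C ∷ mirrorPairs C W) →
                                          EvenAbout C (eval′ p)
centred-mirror-factorisation⇒eval′-even {p} {c} C W fac a = begin
  eval′ p (C - a)                                   ≡⟨ eval′-factorisation fac (C - a) ⟩
  c * eval′ (prodLin (C ∷ mirrorPairs C W)) (C - a) ≡⟨ cong (c *_) (eval′-centred-mirrorPairs-even C W a) ⟩
  c * eval′ (prodLin (C ∷ mirrorPairs C W)) (C + a) ≡⟨ eval′-factorisation fac (C + a) ⟨
  eval′ p (C + a)                                   ∎

factorisation-deriv-lead : ∀ {p d c xs c′ ys} → HasDegree p (suc d) → Factorisation p c xs →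
                           Factorisation (deriv p) c′ ys → c′ ≡ + suc d * c
factorisation-deriv-lead {p} {d} {c} {xs} {c′} deg fac fac′ = begin
  c′                          ≡⟨ proj₂ (proj₂ (factorisation-degree (HasDegree-deriv {p} deg) fac′)) ⟨
  coeff (deriv p) d           ≡⟨ coeff-deriv p d ⟩
  + suc d * coeff p (suc d)   ≡⟨ cong (+ suc d *_) (proj₂ (proj₂ (factorisation-degree deg fac))) ⟩
  + suc d * c                 ∎

simple-root⇒eval′≢0 : ∀ {p d c xs} C → HasDegree p d → Factorisation p c xs → eval p C ≡ 0ℤ →
                      ¬ (C ^ 2 ∣ₚ p) → eval′ p C ≢ 0ℤ
simple-root⇒eval′≢0 {c = c} C deg fac pC≡0 ¬C²∣p p′C≡0 =
  ¬C²∣p (double-root-divides C fac′ (*-≡0⇒≡0 c c≢0 (trans (sym (eval′-at-factored-root fac′)) p′C≡0)))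
  where
  c≢0 = proj₁ (factorisation-degree deg fac)
  fac′ = proj₂ (proj₂ (factor-root C c≢0 fac pC≡0))

eval″-centre-≢0 : ∀ {p c} C w W → Factorisation p c (mirrorPairs C (w ∷ W)) → eval p C ≢ 0ℤ → eval″ p C ≢ 0ℤ
eval″-centre-≢0 {p} {c} C w W fac pC≢0 p″C≡0 = cofactorSquareSum-≢0 w W ∏W≢0 css≡0
  where
  g = -1ℤ ^ suc (length W)
  value : eval p C ≡ c * (g * (w * ∏ W * (w * ∏ W)))
  value = eval-mirrorPairs-centre C (w ∷ W) fac
  curvature : eval″ p C ≡ c * (g * - + cofactorSquareSum (w ∷ W))
  curvature = trans (eval″-factorisation fac C) (cong (c *_) (eval″-mirrorPairs-centre C (w ∷ W)))
  c≢0 : c ≢ 0ℤ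
  c≢0 c≡0 = pC≢0 (trans value (cong (_* (g * (w * ∏ W * (w * ∏ W)))) c≡0))
  ∏W≢0 : ∏ W ≢ 0ℤ
  ∏W≢0 ∏W≡0 = pC≢0 (trans value (trans (cong (λ v → c * (g * (w * v * (w * v)))) ∏W≡0) (vanish c g w)))
    where
    vanish : ∀ c g w → c * (g * (w * 0ℤ * (w * 0ℤ))) ≡ 0ℤ
    vanish = solve-∀
  css≡0 : cofactorSquareSum (w ∷ W) ≡ 0
  css≡0 = ℤP.+-injective (ℤP.neg-injective {j = 0ℤ}
            (*-≡0⇒≡0 g (-1^n≢0 (suc (length W))) (*-≡0⇒≡0 c c≢0 (trans (sym curvature) p″C≡0))))

-- The degree of a nice antisymmetric polynomial

antisymmetric-odd-square : ∀ {p d c xs c′ ys} C → HasDegree p d → Factorisation p c xs →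
                           Factorisation (deriv p) c′ ys → OddAbout C (eval p) → eval′ p C ≢ 0ℤ → OddSquare d
antisymmetric-odd-square {p} {d} {c} {xs} {c′} {ys} C deg fac fac′ odd p′C≢0 =
  subst OddSquare (sym d≡1+2m) (odd-square-ratio m A B ∏V≢0 A²≡dB²)
  where
  antisym = antisymmetric-factorisation C deg fac odd p′C≢0
  W = proj₁ antisym
  m = length W
  d≡1+2m = proj₁ (proj₂ antisym)
  facW = proj₂ (proj₂ antisym)
  deg₁ : HasDegree p (suc (2 ℕ.* m))
  deg₁ = subst (HasDegree p) d≡1+2m deg
  sym′ = symmetric-factorisation C (HasDegree-deriv {p} deg₁) fac′ (centred-mirror-factorisation⇒eval′-even C W facW) p′C≢0
  V = proj₁ sym′
  facV = proj₂ (proj₂ sym′)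
  |V|≡m : length V ≡ m
  |V|≡m = ℕP.*-cancelˡ-≡ (length V) m 2 (sym (proj₁ (proj₂ sym′)))
  c≢0 = proj₁ (factorisation-degree deg fac)
  A = ∏ W
  B = ∏ V
  g = -1ℤ ^ m
  value-via-V : eval′ p C ≡ c′ * (g * (B * B))
  value-via-V = trans (eval-mirrorPairs-centre C V facV) (cong (λ n → c′ * (-1ℤ ^ n * (B * B))) |V|≡m)
  two-values : c * (g * (A * A)) ≡ c * (g * (+ suc (2 ℕ.* m) * (B * B)))
  two-values = begin
    c * (g * (A * A))                        ≡⟨ eval′-centred-mirrorPairs-centre C W facW ⟨
    eval′ p C                                ≡⟨ value-via-V ⟩
    c′ * (g * (B * B))                       ≡⟨ cong (λ v → v * (g * (B * B))) (factorisation-deriv-lead deg₁ fac fac′) ⟩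
    + suc (2 ℕ.* m) * c * (g * (B * B))      ≡⟨ regroup (+ suc (2 ℕ.* m)) c g (B * B) ⟩
    c * (g * (+ suc (2 ℕ.* m) * (B * B)))    ∎
    where
    regroup : ∀ d c g X → d * c * (g * X) ≡ c * (g * (d * X))
    regroup = solve-∀
  A²≡dB² : A * A ≡ + suc (2 ℕ.* m) * (B * B)
  A²≡dB² = *-cancelˡ-≢0 g (-1^n≢0 m) (*-cancelˡ-≢0 c c≢0 two-values)
  ∏V≢0 : B ≢ 0ℤ
  ∏V≢0 B≡0 = p′C≢0 (trans value-via-V (trans (cong (λ v → c′ * (g * (v * v))) B≡0) (vanish c′ g)))
    where
    vanish : ∀ c g → c * (g * (0ℤ * 0ℤ)) ≡ 0ℤ
    vanish = solve-∀

symmetric-odd-square : ∀ {p d c xs c′ ys c″ zs} C → HasDegree p (suc d) → Factorisation p c xs →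
                       Factorisation (deriv p) c′ ys → Factorisation (deriv (deriv p)) c″ zs →
                       EvenAbout C (eval p) → eval p C ≢ 0ℤ → OddSquare d
symmetric-odd-square {p} {d} {c} C deg fac fac′ fac″ even pC≢0 =
  antisymmetric-odd-square C (HasDegree-deriv {p} deg) fac′ fac″ (mirror-factorisation⇒eval′-odd C W facW) (p″C≢0 W (proj₁ (proj₂ sym′)) facW)
  where
  sym′ = symmetric-factorisation C deg fac even pC≢0
  W = proj₁ sym′
  facW = proj₂ (proj₂ sym′)
  p″C≢0 : ∀ W → suc d ≡ 2 ℕ.* length W → Factorisation p c (mirrorPairs C W) → eval″ p C ≢ 0ℤ
  p″C≢0 []      ()
  p″C≢0 (w ∷ W) _ facW = eval″-centre-≢0 C w W facW pC≢0

corollary5p2 : ((p : Poly) (d : ℕ) (C : ℤ) →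
    Nice p → HasDegree p d → 3 ≤ d →
    AntisymmetricAbout p C → SimpleRoot C p →
    OddSquare d)
    ×
    ((p : Poly) (d : ℕ) (C : ℤ) →
    HasDegree p d → 4 ≤ d →
    SymmetricAbout p C → SplitsOverℤ p → ¬ (eval p C ≡ + 0) →
    Nice (deriv p) →
    OddSquare (d ∸ 1))
corollary5p2 =
  (λ where
    p d C (_ , _ , _ , (c , xs , p≈) , (c′ , ys , p′≈)) deg _ (_ , odd) (_ , ¬C²∣p) →
      let fac = factorised {p} {c} {xs} p≈ in
      antisymmetric-odd-square C deg fac (factorised {deriv p} {c′} {ys} p′≈) odd
        (simple-root⇒eval′≢0 C deg fac (OddAbout⇒centre≡0 {C} {eval p} odd) ¬C²∣p)) ,
  (λ where
    p zero    C _   ()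
    p (suc d) C deg _ (_ , even) (c , xs , p≈) pC≢0 (_ , _ , _ , (c′ , ys , p′≈) , (c″ , zs , p″≈)) →
      symmetric-odd-square C deg (factorised {p} {c} {xs} p≈) (factorised {deriv p} {c′} {ys} p′≈)
        (factorised {deriv (deriv p)} {c″} {zs} p″≈) even pC≢0)
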